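{- Let $t\ge1$, let $G$ be a graph with $\mu(G)\le t$, and let $v\in V(G)$. Then there is an optimal $\mathcal{SD}_t$-coloring $\varphi$ of $G$ with $v\in I(\varphi)$ if and only if $\chi_t(G-v)<\chi_t(G)$.
   Context: All graphs are finite, undirected, loopless, and may have multiple edges; $\mu(G)$ is the maximum number of edges joining two distinct vertices. A graph is strictly $t$-degenerate if every non-empty subgraph $H$ has a vertex of degree (with multiplicity) at most $t-1$ in $H$. An $\mathcal{SD}_t$-coloring of $G$ is a map $\varphi:V(G)\to\Gamma$ such that each color class induces a strictly $t$-degenerate subgraph; $\chi_t(G)$ is the least number of colors in such a coloring. $\varphi$ is optimal if the number of non-empty color classes equals $\chi_t(G)$. $I(\varphi)$ is the set of vertices $v$ whose color class is $\{v\}$. -}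

module Defs where

open import Data.Nat using (ℕ; zero; suc; _+_; _≤_; _<_)
open import Data.Fin using (Fin; zero; suc; punchIn)
open import Data.Fin.Subset using (Subset; _∈_; _∉_; _⊆_)
open import Data.Product using (Σ; ∃; _×_; _,_)
open import Relation.Binary.PropositionalEquality using (_≡_; _≢_)
open import Data.Vec using (tabulate)
open import Data.Nat using (_≟_)
open import Relation.Nullary.Decidable using (⌊_⌋)

-- A finite loopless multigraph on vertex set Fin n:
-- mult u w = number of edges joining u and w.
record Graph (n : ℕ) : Set where
  field
    mult     : Fin n → Fin n → ℕ
    symm     : ∀ u w → mult u w ≡ mult w u
    loopless : ∀ u → mult u u ≡ 0
open Graph public

-- μ(G): maximum edge multiplicity; we state μ(G) ≤ t directly.
μ≤ : ∀ {n} → Graph n → ℕ → Set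
μ≤ G t = ∀ u w → mult G u w ≤ t

sumFin : ∀ n → (Fin n → ℕ) → ℕ
sumFin zero    f = 0
sumFin (suc n) f = f zero + sumFin n (λ i → f (suc i))

record Subgraph {n : ℕ} (G : Graph n) : Set where
  field
    V     : Subset n
    emult : Fin n → Fin n → ℕ
    esymm : ∀ u w → emult u w ≡ emult w u
    ≤G    : ∀ u w → emult u w ≤ mult G u w
    inV   : ∀ u w → u ∉ V → emult u w ≡ 0
open Subgraph public

degIn : ∀ {n} {G : Graph n} → Subgraph G → Fin n → ℕ
degIn {n} H u = sumFin n (λ w → emult H u w)

-- G[S] is strictly t-degenerate: every non-empty subgraph of G[S]
-- (i.e. every subgraph of G whose vertex set lies in S) has a vertex
-- of degree at most t-1 (equivalently, < t).
StrictlyDegenerateOn : ∀ {n} → Graph n → ℕ → Subset n → Set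
StrictlyDegenerateOn G t S =
  ∀ (H : Subgraph G) → V H ⊆ S → (∃ λ u → u ∈ V H) →
  ∃ λ u → u ∈ V H × degIn H u < t

-- Colors are natural numbers (Γ = ℕ).  Color class of c under φ.
colorClass : ∀ {n} → (Fin n → ℕ) → ℕ → Subset n
colorClass φ c = tabulate (λ u → ⌊ φ u ≟ c ⌋)

IsSDColoring : ∀ {n} → Graph n → ℕ → (Fin n → ℕ) → Set
IsSDColoring G t φ = ∀ c → StrictlyDegenerateOn G t (colorClass φ c)

-- φ uses exactly k colors (has exactly k non-empty color classes):
-- there are representatives r 0, …, r (k-1) with pairwise distinct colors
-- such that every vertex has the color of some representative.
NumClasses : ∀ {n} → (Fin n → ℕ) → ℕ → Set
NumClasses {n} φ k =
  Σ (Fin k → Fin n) λ r →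
    (∀ i j → φ (r i) ≡ φ (r j) → i ≡ j) ×
    (∀ u → ∃ λ i → φ u ≡ φ (r i))

-- χ_t(G) = k : there is an SD_t-coloring with at most k colors
-- (i.e. with colors from {0,…,k-1}), and none with fewer.
ColorsBelow : ∀ {n} → (Fin n → ℕ) → ℕ → Set
ColorsBelow φ k = ∀ u → φ u < k

IsChi : ∀ {n} → Graph n → ℕ → ℕ → Set
IsChi G t k =
  (∃ λ φ → IsSDColoring G t φ × ColorsBelow φ k) ×
  (∀ j φ → IsSDColoring G t φ → ColorsBelow φ j → k ≤ j)

IsOptimal : ∀ {n} → Graph n → ℕ → ℕ → (Fin n → ℕ) → Set
IsOptimal G t k φ = IsSDColoring G t φ × NumClasses φ k

-- v ∈ I(φ): the color class of v is {v}
InI : ∀ {n} → (Fin n → ℕ) → Fin n → Set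
InI φ v = ∀ u → φ u ≡ φ v → u ≡ v

deleteVertex : ∀ {n} → Graph (suc n) → Fin (suc n) → Graph n
deleteVertex G v = record
  { mult     = λ i j → mult G (punchIn v i) (punchIn v j)
  ; symm     = λ i j → symm G (punchIn v i) (punchIn v j)
  ; loopless = λ i → loopless G (punchIn v i)
  }

-- If v is alone in its colour class of an optimal SD_t-colouring of G, deleting v
-- together with that class colours G − v with χ_t(G) − 1 colours. Conversely, an
-- optimal colouring of G − v extended by a fresh colour on v is an SD_t-colouring of
-- G, since a single vertex of a loopless graph is strictly t-degenerate for t ≥ 1.
-- It has at most χ_t(G) colours, hence exactly χ_t(G) non-empty classes: an unused
-- colour below the top one could absorb the top class, contradicting minimality.
module Submission where

open import Defs
open import Data.Nat using (ℕ; zero; suc; _+_; _≤_; _<_; z≤n; s≤s; _≟_)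
open import Data.Nat.Properties
  using (≤-refl; ≤-pred; <⇒≤; ≤-<-trans; <-irrefl; ≤∧≢⇒<; n≤0⇒n≡0; +-commutativeSemigroup)
open import Algebra.Properties.CommutativeSemigroup +-commutativeSemigroup
  using (x∙yz≈y∙xz)
open import Data.Bool using (Bool; true)
open import Data.Bool.Properties using (T-≡)
open import Data.Empty using (⊥-elim)
open import Data.Fin using (Fin; zero; suc; punchIn; punchOut; toℕ; fromℕ<)
open import Data.Fin.Properties
  using (punchInᵢ≢i; punchIn-punchOut; punchOut-injective; toℕ-injective; toℕ<n;
         toℕ-fromℕ<; any?)
  renaming (_≟_ to _≟ᶠ_)
open import Data.Fin.Subset using (Subset; _∈_; _∉_; _⊆_; outside)
open import Data.Product using (∃; _×_; _,_; proj₁; proj₂)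
open import Data.Vec as Vec using (tabulate; lookup)
open import Data.Vec.Properties using ([]=⇒lookup; lookup⇒[]=; lookup∘tabulate)
import Data.Vec.Properties as Vecₚ
open import Data.Vec.Functional using (insertAt; removeAt)
open import Data.Vec.Functional.Properties using (insertAt-lookup; insertAt-punchIn)
open import Function using (_∘_)
open import Function.Bundles using (_⇔_; mk⇔; Equivalence)
open import Relation.Binary.PropositionalEquality
open import Relation.Nullary using (yes; no)
open import Relation.Nullary.Decidable using (isYes≗does; dec-true; toWitness)

∈-tabulate⁺ : ∀ {n} {f : Fin n → Bool} {u} → f u ≡ true → u ∈ tabulate f
∈-tabulate⁺ {f = f} {u} fu≡true = lookup⇒[]= u (tabulate f) (trans (lookup∘tabulate f u) fu≡true)

∈-tabulate⁻ : ∀ {n} {f : Fin n → Bool} {u} → u ∈ tabulate f → f u ≡ true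
∈-tabulate⁻ {f = f} {u} u∈ = trans (sym (lookup∘tabulate f u)) ([]=⇒lookup u∈)

∈-colorClass⁺ : ∀ {n} {φ : Fin n → ℕ} {c u} → φ u ≡ c → u ∈ colorClass φ c
∈-colorClass⁺ {φ = φ} {c} {u} φu≡c = ∈-tabulate⁺ (trans (isYes≗does (φ u ≟ c)) (dec-true (φ u ≟ c) φu≡c))

∈-colorClass⁻ : ∀ {n} {φ : Fin n → ℕ} {c u} → u ∈ colorClass φ c → φ u ≡ c
∈-colorClass⁻ {φ = φ} {c} {u} u∈ =
  toWitness {a? = φ u ≟ c} (Equivalence.from T-≡ (∈-tabulate⁻ u∈))

sumFin-cong : ∀ n {f g : Fin n → ℕ} → (∀ i → f i ≡ g i) → sumFin n f ≡ sumFin n g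
sumFin-cong zero    f≗g = refl
sumFin-cong (suc n) f≗g = cong₂ _+_ (f≗g zero) (sumFin-cong n (f≗g ∘ suc))

sumFin-zero : ∀ n {f : Fin n → ℕ} → (∀ i → f i ≡ 0) → sumFin n f ≡ 0
sumFin-zero zero    f≗0 = refl
sumFin-zero (suc n) f≗0 = cong₂ _+_ (f≗0 zero) (sumFin-zero n (f≗0 ∘ suc))

sumFin-punchIn : ∀ n (v : Fin (suc n)) (f : Fin (suc n) → ℕ) →
                 sumFin (suc n) f ≡ f v + sumFin n (f ∘ punchIn v)
sumFin-punchIn n       zero    f = refl
sumFin-punchIn (suc n) (suc v) f = begin
  f zero + sumFin (suc n) (f ∘ suc)
    ≡⟨ cong (f zero +_) (sumFin-punchIn n v (f ∘ suc)) ⟩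
  f zero + (f (suc v) + sumFin n (f ∘ suc ∘ punchIn v))
    ≡⟨ x∙yz≈y∙xz (f zero) (f (suc v)) _ ⟩
  f (suc v) + (f zero + sumFin n (f ∘ suc ∘ punchIn v))
    ∎
  where open ≡-Reasoning

data PunchInView {n} (v : Fin (suc n)) : Fin (suc n) → Set where
  at-v    : PunchInView v v
  punched : ∀ i → PunchInView v (punchIn v i)

punchInView : ∀ {n} (v u : Fin (suc n)) → PunchInView v u
punchInView v u with v ≟ᶠ u
... | yes refl = at-v
... | no v≢u   = subst (PunchInView v) (punchIn-punchOut v≢u) (punched (punchOut v≢u))

module _ {n} (v : Fin (suc n)) {ψ : Fin n → ℕ} {k : ℕ} (ψ<k : ColorsBelow ψ k) where

  InI-insertAt : InI (insertAt ψ v k) v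
  InI-insertAt u same with punchInView v u
  ... | at-v      = refl
  ... | punched i = ⊥-elim (<-irrefl ψi≡k (ψ<k i))
    where
      ψi≡k : ψ i ≡ k
      ψi≡k = trans (sym (insertAt-punchIn ψ v k i)) (trans same (insertAt-lookup ψ v k))

  insertAt-ColorsBelow : ∀ {j} → k < j → ColorsBelow (insertAt ψ v k) j
  insertAt-ColorsBelow k<j u = ≤-<-trans (insertAt-≤ u) k<j
    where
      insertAt-≤ : ∀ u → insertAt ψ v k u ≤ k
      insertAt-≤ u with punchInView v u
      ... | at-v      = subst (_≤ k) (sym (insertAt-lookup ψ v k)) ≤-refl
      ... | punched i = subst (_≤ k) (sym (insertAt-punchIn ψ v k i)) (<⇒≤ (ψ<k i))

module _ {n} (G : Graph n) (t : ℕ) where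

  strictlyDegenerateOn-singleton : 1 ≤ t → ∀ v {S : Subset n} → (∀ {u} → u ∈ S → u ≡ v) →
                                   StrictlyDegenerateOn G t S
  strictlyDegenerateOn-singleton t≥1 v onlyV H V⊆S (u , u∈) =
    u , u∈ , subst (_< t) (sym (sumFin-zero n noEdge)) t≥1
    where
      noEdge : ∀ w → emult H u w ≡ 0
      noEdge w with u ≟ᶠ w
      ... | yes refl = n≤0⇒n≡0 (subst (emult H u u ≤_) (loopless G u) (≤G H u u))
      ... | no u≢w   = trans (esymm H u w) (inV H w u λ w∈ →
                         u≢w (trans (onlyV (V⊆S u∈)) (sym (onlyV (V⊆S w∈)))))

  refineSDColoring : ∀ {φ ψ : Fin n → ℕ} → IsSDColoring G t φ →
                     (∀ u w → ψ u ≡ ψ w → φ u ≡ φ w) → IsSDColoring G t ψ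
  refineSDColoring {φ} sd refines c H V⊆ (u₀ , u₀∈) = sd (φ u₀) H V⊆class (u₀ , u₀∈)
    where
      V⊆class : V H ⊆ colorClass φ (φ u₀)
      V⊆class u∈ = ∈-colorClass⁺
        (refines _ u₀ (trans (∈-colorClass⁻ (V⊆ u∈)) (sym (∈-colorClass⁻ (V⊆ u₀∈)))))

  χ-LowerBound : ℕ → Set
  χ-LowerBound k = ∀ j φ → IsSDColoring G t φ → ColorsBelow φ j → k ≤ j

  recolour : ℕ → ℕ → ℕ → ℕ
  recolour from to x with x ≟ from
  ... | yes _ = to
  ... | no  _ = x

  recolour-< : ∀ {m to x} → to < suc m → x < suc m → x ≢ to → recolour m to x < m
  recolour-< {m} {to} {x} to<1+m x<1+m x≢to with x ≟ m
  ... | yes x≡m = ≤∧≢⇒< (≤-pred to<1+m) λ to≡m → x≢to (trans x≡m (sym to≡m))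
  ... | no  x≢m = ≤∧≢⇒< (≤-pred x<1+m) x≢m

  recolour-injective : ∀ {m to x y} → x ≢ to → y ≢ to → recolour m to x ≡ recolour m to y → x ≡ y
  recolour-injective {m} {to} {x} {y} x≢to y≢to same with x ≟ m | y ≟ m
  ... | yes x≡m | yes y≡m = trans x≡m (sym y≡m)
  ... | yes _   | no  _   = ⊥-elim (y≢to (sym same))
  ... | no  _   | yes _   = ⊥-elim (x≢to same)
  ... | no  _   | no  _   = same

  unusedColour-removable : ∀ {φ m c} → IsSDColoring G t φ → ColorsBelow φ (suc m) → c < suc m →
                           (∀ u → φ u ≢ c) → ∃ λ ψ → IsSDColoring G t ψ × ColorsBelow ψ m
  unusedColour-removable {φ} {m} {c} sd φ<1+m c<1+m unused =
    recolour m c ∘ φ ,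
    refineSDColoring sd (λ u w → recolour-injective (unused u) (unused w)) ,
    λ u → recolour-< c<1+m (φ<1+m u) (unused u)

  minimal-surjective : ∀ {k φ} → χ-LowerBound k → IsSDColoring G t φ → ColorsBelow φ k →
                       ∀ c → c < k → ∃ λ u → φ u ≡ c
  minimal-surjective {suc m} {φ} k-minimal sd φ<k c c<k with any? (λ u → φ u ≟ c)
  ... | yes used  = used
  ... | no unused =
    let ψ , ψ-sd , ψ<m = unusedColour-removable sd φ<k c<k (λ u φu≡c → unused (u , φu≡c))
    in  ⊥-elim (<-irrefl refl (k-minimal m ψ ψ-sd ψ<m))

NumClasses-surjective : ∀ {n k} {φ : Fin n → ℕ} → ColorsBelow φ k →
                        (∀ c → c < k → ∃ λ u → φ u ≡ c) → NumClasses φ k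
NumClasses-surjective {φ = φ} φ<k surjective = representative , injective , covered
  where
    representative : Fin _ → Fin _
    representative c = proj₁ (surjective (toℕ c) (toℕ<n c))

    colour-representative : ∀ c → φ (representative c) ≡ toℕ c
    colour-representative c = proj₂ (surjective (toℕ c) (toℕ<n c))

    injective : ∀ i j → φ (representative i) ≡ φ (representative j) → i ≡ j
    injective i j same = toℕ-injective
      (trans (sym (colour-representative i)) (trans same (colour-representative j)))

    covered : ∀ u → ∃ λ i → φ u ≡ φ (representative i)
    covered u = fromℕ< (φ<k u) ,
      sym (trans (colour-representative (fromℕ< (φ<k u))) (toℕ-fromℕ< (φ<k u)))

module VertexDeletion {n} (G : Graph (suc n)) (v : Fin (suc n)) where

  G-v : Graph n
  G-v = deleteVertex G v

  liftMult : Subgraph G-v → Fin (suc n) → Fin (suc n) → ℕ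
  liftMult H = insertAt (λ i → insertAt (emult H i) v 0) v (λ _ → 0)

  liftMult-v· : ∀ H b → liftMult H v b ≡ 0
  liftMult-v· H b = cong-app (insertAt-lookup _ v _) b

  liftMult-·v : ∀ H a → liftMult H a v ≡ 0
  liftMult-·v H a with punchInView v a
  ... | at-v      = liftMult-v· H v
  ... | punched i = trans (cong-app (insertAt-punchIn _ v _ i) v) (insertAt-lookup (emult H i) v 0)

  liftMult-punchIn : ∀ H i j → liftMult H (punchIn v i) (punchIn v j) ≡ emult H i j
  liftMult-punchIn H i j =
    trans (cong-app (insertAt-punchIn _ v _ i) (punchIn v j)) (insertAt-punchIn (emult H i) v 0 j)

  liftMult-symm : ∀ H a b → liftMult H a b ≡ liftMult H b a
  liftMult-symm H a b with punchInView v a | punchInView v b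
  ... | at-v      | _         = trans (liftMult-v· H b) (sym (liftMult-·v H b))
  ... | punched i | at-v      = trans (liftMult-·v H _) (sym (liftMult-v· H _))
  ... | punched i | punched j =
    trans (liftMult-punchIn H i j) (trans (esymm H i j) (sym (liftMult-punchIn H j i)))

  liftMult-≤ : ∀ H a b → liftMult H a b ≤ mult G a b
  liftMult-≤ H a b with punchInView v a | punchInView v b
  ... | at-v      | _         = subst (_≤ _) (sym (liftMult-v· H b)) z≤n
  ... | punched i | at-v      = subst (_≤ _) (sym (liftMult-·v H _)) z≤n
  ... | punched i | punched j = subst (_≤ _) (sym (liftMult-punchIn H i j)) (≤G H i j)

  liftVertices : Subgraph G-v → Subset (suc n)
  liftVertices H = Vec.insertAt (V H) v outside

  ∈-liftVertices⁺ : ∀ {H i} → i ∈ V H → punchIn v i ∈ liftVertices H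
  ∈-liftVertices⁺ {H} {i} i∈ =
    lookup⇒[]= _ _ (trans (Vecₚ.insertAt-punchIn (V H) v outside i) ([]=⇒lookup i∈))

  ∈-liftVertices⁻ : ∀ {H u} → u ∈ liftVertices H → ∃ λ i → u ≡ punchIn v i × i ∈ V H
  ∈-liftVertices⁻ {H} {u} u∈ with punchInView v u
  ... | punched i = i , refl ,
    lookup⇒[]= i (V H) (trans (sym (Vecₚ.insertAt-punchIn (V H) v outside i)) ([]=⇒lookup u∈))
  ... | at-v with trans (sym (Vecₚ.insertAt-lookup (V H) v outside)) ([]=⇒lookup u∈)
  ...   | ()

  liftMult-outside : ∀ H a b → a ∉ liftVertices H → liftMult H a b ≡ 0
  liftMult-outside H a b a∉ with punchInView v a | punchInView v b
  ... | at-v      | _         = liftMult-v· H b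
  ... | punched i | at-v      = liftMult-·v H _
  ... | punched i | punched j =
    trans (liftMult-punchIn H i j) (inV H i j (a∉ ∘ ∈-liftVertices⁺ {H}))

  liftSubgraph : Subgraph G-v → Subgraph G
  liftSubgraph H = record
    { V     = liftVertices H
    ; emult = liftMult H
    ; esymm = liftMult-symm H
    ; ≤G    = liftMult-≤ H
    ; inV   = liftMult-outside H
    }

  degIn-liftSubgraph : ∀ H i → degIn (liftSubgraph H) (punchIn v i) ≡ degIn H i
  degIn-liftSubgraph H i =
    trans (sumFin-punchIn n v (liftMult H (punchIn v i)))
          (cong₂ _+_ (liftMult-·v H _) (sumFin-cong n (liftMult-punchIn H i)))

  restrictSubgraph : Subgraph G → Subgraph G-v
  restrictSubgraph H = record
    { V     = tabulate (lookup (V H) ∘ punchIn v)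
    ; emult = λ i j → emult H (punchIn v i) (punchIn v j)
    ; esymm = λ i j → esymm H _ _
    ; ≤G    = λ i j → ≤G H _ _
    ; inV   = λ i j i∉ → inV H _ _ (i∉ ∘ ∈-tabulate⁺ ∘ []=⇒lookup)
    }

  ∈-restrictSubgraph⁺ : ∀ {H i} → punchIn v i ∈ V H → i ∈ V (restrictSubgraph H)
  ∈-restrictSubgraph⁺ = ∈-tabulate⁺ ∘ []=⇒lookup

  ∈-restrictSubgraph⁻ : ∀ {H i} → i ∈ V (restrictSubgraph H) → punchIn v i ∈ V H
  ∈-restrictSubgraph⁻ {H} {i} = lookup⇒[]= (punchIn v i) (V H) ∘ ∈-tabulate⁻

  degIn-restrictSubgraph : ∀ H → v ∉ V H → ∀ i → degIn H (punchIn v i) ≡ degIn (restrictSubgraph H) i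
  degIn-restrictSubgraph H v∉ i =
    trans (sumFin-punchIn n v (emult H (punchIn v i)))
          (cong (_+ degIn (restrictSubgraph H) i) (trans (esymm H _ v) (inV H v _ v∉)))

  module _ (t : ℕ) where

    strictlyDegenerateOn-deleteVertex : ∀ {S T} → StrictlyDegenerateOn G t S →
      (∀ {i} → i ∈ T → punchIn v i ∈ S) → StrictlyDegenerateOn G-v t T
    strictlyDegenerateOn-deleteVertex degenerate T→S H V⊆T (i₀ , i₀∈)
      with degenerate (liftSubgraph H) lift⊆S (punchIn v i₀ , ∈-liftVertices⁺ {H} i₀∈)
      where
        lift⊆S : liftVertices H ⊆ _
        lift⊆S u∈ with ∈-liftVertices⁻ {H} u∈
        ... | i , refl , i∈ = T→S (V⊆T i∈)
    ... | u , u∈ , deg<t with ∈-liftVertices⁻ {H} u∈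
    ...   | i , refl , i∈ = i , i∈ , subst (_< t) (degIn-liftSubgraph H i) deg<t

    strictlyDegenerateOn-insertVertex : ∀ {S T} → StrictlyDegenerateOn G-v t T → v ∉ S →
      (∀ {i} → punchIn v i ∈ S → i ∈ T) → StrictlyDegenerateOn G t S
    strictlyDegenerateOn-insertVertex degenerate v∉S S→T H V⊆S (u₀ , u₀∈)
      with punchInView v u₀
    ... | at-v       = ⊥-elim (v∉S (V⊆S u₀∈))
    ... | punched i₀
      with degenerate (restrictSubgraph H) (S→T ∘ V⊆S ∘ ∈-restrictSubgraph⁻ {H})
                      (i₀ , ∈-restrictSubgraph⁺ {H} u₀∈)
    ...   | i , i∈ , deg<t = punchIn v i , ∈-restrictSubgraph⁻ {H} i∈ ,
      subst (_< t) (sym (degIn-restrictSubgraph H (v∉S ∘ V⊆S) i)) deg<t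

    SDColoring-removeAt : ∀ {φ} → IsSDColoring G t φ → IsSDColoring G-v t (removeAt φ v)
    SDColoring-removeAt {φ} sd c =
      strictlyDegenerateOn-deleteVertex (sd c) λ i∈ →
        ∈-colorClass⁺ {φ = φ} (∈-colorClass⁻ {φ = removeAt φ v} i∈)

    SDColoring-insertAt : ∀ {ψ k} → 1 ≤ t → IsSDColoring G-v t ψ → ColorsBelow ψ k →
                          IsSDColoring G t (insertAt ψ v k)
    SDColoring-insertAt {ψ} {k} t≥1 sd ψ<k c with c ≟ k
    ... | yes refl = strictlyDegenerateOn-singleton G t t≥1 v λ u∈ →
      InI-insertAt v ψ<k _
        (trans (∈-colorClass⁻ {φ = insertAt ψ v k} u∈) (sym (insertAt-lookup ψ v k)))
    ... | no c≢k = strictlyDegenerateOn-insertVertex (sd c)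
      (λ v∈ → c≢k (trans (sym (∈-colorClass⁻ {φ = insertAt ψ v k} v∈)) (insertAt-lookup ψ v k)))
      (λ {i} i∈ → ∈-colorClass⁺ {φ = ψ}
        (trans (sym (insertAt-punchIn ψ v k i)) (∈-colorClass⁻ {φ = insertAt ψ v k} i∈)))

    SDColoring-removeIsolated : ∀ {φ m} → IsSDColoring G t φ → NumClasses φ (suc m) → InI φ v →
                                ∃ λ ψ → IsSDColoring G-v t ψ × ColorsBelow ψ m
    SDColoring-removeIsolated {φ} sd (representative , _ , covered) v-isolated =
      ψ , refineSDColoring G-v t (SDColoring-removeAt {φ} sd) refines , λ i → toℕ<n _
      where
        class : Fin (suc n) → Fin _
        class u = proj₁ (covered u)

        colour-class : ∀ u → φ u ≡ φ (representative (class u))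
        colour-class u = proj₂ (covered u)

        class-v≢ : ∀ i → class v ≢ class (punchIn v i)
        class-v≢ i same = punchInᵢ≢i v i (v-isolated (punchIn v i)
          (trans (colour-class _) (trans (cong (φ ∘ representative) (sym same))
                                         (sym (colour-class v)))))

        ψ : Fin n → ℕ
        ψ i = toℕ (punchOut (class-v≢ i))

        refines : ∀ i j → ψ i ≡ ψ j → φ (punchIn v i) ≡ φ (punchIn v j)
        refines i j same = trans (colour-class _)
          (trans (cong (φ ∘ representative)
                       (punchOut-injective (class-v≢ i) (class-v≢ j) (toℕ-injective same)))
                 (sym (colour-class _)))

    isolatedClass⇒fewerColours : ∀ {φ k k′} → χ-LowerBound G-v t k′ → IsSDColoring G t φ →
                                 NumClasses φ k → InI φ v → k′ < k
    isolatedClass⇒fewerColours {k = zero} _ _ (_ , _ , covered) _ with covered v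
    ... | () , _
    isolatedClass⇒fewerColours {k = suc m} k′-minimal sd classes v-isolated =
      let ψ , ψ-sd , ψ<m = SDColoring-removeIsolated sd classes v-isolated
      in  s≤s (k′-minimal m ψ ψ-sd ψ<m)

proposition19 : (t : ℕ) → 1 ≤ t → (n : ℕ) → (G : Graph (suc n)) → μ≤ G t →
    (v : Fin (suc n)) → (k k′ : ℕ) → IsChi G t k → IsChi (deleteVertex G v) t k′ →
    ((∃ λ φ → IsOptimal G t k φ × InI φ v) ⇔ (k′ < k))
proposition19 t t≥1 n G _ v k k′ (_ , k-minimal) ((ψ , ψ-sd , ψ<k′) , k′-minimal) =
  mk⇔ (λ (φ , (φ-sd , φ-classes) , v-isolated) →
         isolatedClass⇒fewerColours t k′-minimal φ-sd φ-classes v-isolated)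
      (λ k′<k → let φ<k = insertAt-ColorsBelow v ψ<k′ k′<k in
         φ , (φ-sd , NumClasses-surjective φ<k (minimal-surjective G t k-minimal φ-sd φ<k)) ,
         InI-insertAt v ψ<k′)
  where
    open VertexDeletion G v

    φ : Fin (suc n) → ℕ
    φ = insertAt ψ v k′

    φ-sd : IsSDColoring G t φ
    φ-sd = SDColoring-insertAt t t≥1 ψ-sd ψ<k′
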